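{- For every finite simple graph $G$, $\mathrm{sl}(G)=\mathrm{nd}(G)$.
   Context: For a decoder $\mathcal{D}\subseteq\Sigma^2$ and a word $w=w_1\cdots w_n\in\Sigma^*$, the letter graph $G(\mathcal{D},w)$ has vertex set $\{1,\dots,n\}$ and edge set $\{\{i,j\}\mid 1\le i<j\le n,\ w_iw_j\in\mathcal{D}\}$. A decoder is symmetric if $ab\in\mathcal{D}$ iff $ba\in\mathcal{D}$. The symmetric lettericity $\mathrm{sl}(G)$ of $G=(V,E)$ is the smallest size of an alphabet $\Sigma$ such that there are a symmetric decoder $\mathcal{D}\subseteq\Sigma^2$ and a word $w\in\Sigma^{|V|}$ with $G$ isomorphic to $G(\mathcal{D},w)$. Two vertices $u,v$ are generalized twins if $N(u)\setminus\{v\}=N(v)\setminus\{u\}$ ($N$ the open neighborhood). The neighborhood diversity $\mathrm{nd}(G)$ is the smallest number of parts of a partition of $V$ such that any two vertices in the same part are generalized twins. -}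

module Defs where

open import Data.Nat using (ℕ; _≤_)
open import Data.Fin using (Fin; _<?_)
open import Data.Bool using (Bool; true; false; if_then_else_; _∧_)
open import Data.Product using (Σ; ∃; _×_; _,_)
open import Relation.Nullary using (¬_)
open import Relation.Nullary.Decidable using (⌊_⌋)
open import Relation.Binary.PropositionalEquality using (_≡_; _≢_)
open import Function.Bundles using (_⤖_; _⇔_; Bijection)
open import Function.Definitions using (Surjective)

record Graph : Set where
  field
    n     : ℕ
    adj   : Fin n → Fin n → Bool
    sym   : ∀ u v → adj u v ≡ adj v u
    irr   : ∀ u → adj u u ≡ false
open Graph public

record _≅_ (G H : Graph) : Set where
  field
    bij  : Fin (n G) ⤖ Fin (n H)
    pres : ∀ u v → adj G u v ≡ adj H (Bijection.to bij u) (Bijection.to bij v)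

-- A decoder over alphabet Fin k is a set of ordered pairs (two-letter words).
Decoder : ℕ → Set
Decoder k = Fin k → Fin k → Bool

SymmetricDecoder : ∀ {k} → Decoder k → Set
SymmetricDecoder D = ∀ a b → D a b ≡ true ⇔ D b a ≡ true

letterAdj : ∀ {k m} → Decoder k → (Fin m → Fin k) → Fin m → Fin m → Bool
letterAdj D w i j =
  if ⌊ i <? j ⌋ then D (w i) (w j)
  else (if ⌊ j <? i ⌋ then D (w j) (w i) else false)

letterGraph : ∀ {k m} (D : Decoder k) → (Fin m → Fin k) → Graph
letterGraph {k} {m} D w = record
  { n = m ; adj = letterAdj D w ; sym = symAdj ; irr = irrAdj }
  where
  open import Data.Fin.Properties using (<-irrefl; <-asym)
  open import Relation.Nullary using (yes; no)
  open import Relation.Binary.PropositionalEquality using (refl)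
  open import Data.Empty using (⊥-elim)
  symAdj : ∀ u v → letterAdj D w u v ≡ letterAdj D w v u
  symAdj u v with u <? v | v <? u
  ... | yes p | yes q = ⊥-elim (<-asym p q)
  ... | yes p | no _  = refl
  ... | no _  | yes q = refl
  ... | no _  | no _  = refl
  irrAdj : ∀ u → letterAdj D w u u ≡ false
  irrAdj u with u <? u
  ... | yes p = ⊥-elim (<-irrefl refl p)
  ... | no _  = refl

SymLetterRep : Graph → ℕ → Set
SymLetterRep G k =
  Σ (Decoder k) λ D → Σ (SymmetricDecoder D) λ symD →
  Σ (Fin (n G) → Fin k) λ w → G ≅ letterGraph D w

IsSymLettericity : Graph → ℕ → Set
IsSymLettericity G m = SymLetterRep G m × (∀ k → SymLetterRep G k → m ≤ k)

InN : (G : Graph) → Fin (n G) → Fin (n G) → Set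
InN G x u = adj G u x ≡ true

GenTwins : (G : Graph) → Fin (n G) → Fin (n G) → Set
GenTwins G u v = ∀ x → (InN G x u × x ≢ v) ⇔ (InN G x v × x ≢ u)

-- A partition of V into exactly k (nonempty) parts, given by a surjective
-- labelling V → Fin k, such that vertices in the same part are generalized twins.
TwinPartition : Graph → ℕ → Set
TwinPartition G k =
  Σ (Fin (n G) → Fin k) λ p →
    (∀ i → ∃ λ v → p v ≡ i) ×
    (∀ u v → p u ≡ p v → GenTwins G u v)

IsNeighbourhoodDiversity : Graph → ℕ → Set
IsNeighbourhoodDiversity G m = TwinPartition G m × (∀ k → TwinPartition G k → m ≤ k)

-- If vertices with equal labels are generalized twins, the adjacency of two
-- distinct vertices depends only on their labels, so "some edge joins label a
-- to label b" is a symmetric decoder that reads G off the labelling: sl ≤ nd.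
-- Conversely, in a letter graph over a symmetric decoder, positions carrying
-- the same letter are generalized twins, so the word is a twin labelling, and
-- dropping unused letters gives a twin partition with no more parts: nd ≤ sl.
-- Both minima exist since twin partitions of each size can be searched.
module Submission where

open import Defs
open import Data.Nat using (ℕ; zero; suc; _≤_; _<_)
open import Data.Nat.Properties using (≤-refl; ≤-trans; n≤1+n; ≮⇒≥)
open import Data.Nat.Induction using (<-rec)
open import Data.Fin using (Fin; toℕ; fromℕ<; punchOut; finToFun; funToFin; _<?_)
open import Data.Fin.Properties
  using (_≟_; any?; all?; ¬∀⟶∃¬; punchOut-injective; toℕ<n; toℕ-fromℕ<; finToFun-funToFin; <-cmp)
open import Data.Bool using (true)
open import Data.Bool.Properties using (⇔→≡) renaming (_≟_ to _≟ᵇ_)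
open import Data.Product using (∃; ∃₂; _×_; _,_)
open import Function using (id; _∘_)
open import Function.Bundles using (_⇔_; mk⇔; Equivalence; Bijection)
open import Function.Construct.Identity using (⤖-id; ⇔-id)
open import Relation.Nullary using (Dec; yes; no; does; contradiction; ¬?)
open import Relation.Nullary.Decidable using (_×-dec_; _→-dec_; dec-true; does-⇔) renaming (map′ to Dec-map)
open import Relation.Binary using (tri<; tri≈; tri>)
open import Relation.Binary.PropositionalEquality as ≡
  using (_≡_; _≢_; refl; trans; subst; _≗_; ≢-sym; module ≡-Reasoning)

Least : (ℕ → Set) → ℕ → Set
Least P m = P m × (∀ k → P k → m ≤ k)

least : {P : ℕ → Set} → (∀ k → Dec (P k)) → ∀ b → P b → ∃ (Least P)
least {P} P? = <-rec _ search
  where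
  search : ∀ b → (∀ {c} → c < b → P c → ∃ (Least P)) → P b → ∃ (Least P)
  search b smaller Pb with any? (P? ∘ toℕ {b})
  ... | yes (i , Pi) = smaller (toℕ<n i) Pi
  ... | no none      = b , Pb , λ k Pk → ≮⇒≥ λ k<b →
    none (fromℕ< k<b , subst P (≡.sym (toℕ-fromℕ< k<b)) Pk)

_⇔-dec_ : {A B : Set} → Dec A → Dec B → Dec (A ⇔ B)
a? ⇔-dec b? = Dec-map (λ (f , g) → mk⇔ f g) (λ e → Equivalence.to e , Equivalence.from e)
                      ((a? →-dec b?) ×-dec (b? →-dec a?))

does-true : {A : Set} (a? : Dec A) → does a? ≡ true → A
does-true (yes a) _  = a
does-true (no _)  ()

any-function? : ∀ {m k} {P : (Fin m → Fin k) → Set} →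
  (∀ {f g} → f ≗ g → P f → P g) → (∀ f → Dec (P f)) → Dec (∃ P)
any-function? {P = P} resp P? =
  Dec-map (λ (i , Pi) → finToFun i , Pi)
          (λ (f , Pf) → funToFin f , resp (≡.sym ∘ finToFun-funToFin f) Pf)
          (any? (P? ∘ finToFun))

IsOnto : ∀ {m k} → (Fin m → Fin k) → Set
IsOnto p = ∀ i → ∃ λ v → p v ≡ i

IsOnto? : ∀ {m k} (p : Fin m → Fin k) → Dec (IsOnto p)
IsOnto? p = all? λ i → any? λ v → p v ≟ i

-- Unused labels are removed one at a time by punching them out.
shrink-onto : ∀ {m} k (p : Fin m → Fin k) →
  ∃₂ λ k′ (p′ : Fin m → Fin k′) → k′ ≤ k × IsOnto p′ × (∀ u v → p′ u ≡ p′ v → p u ≡ p v)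
shrink-onto zero    p = zero , p , ≤-refl , (λ ()) , λ _ _ → id
shrink-onto (suc k) p with IsOnto? p
... | yes onto = suc k , p , ≤-refl , onto , λ _ _ → id
... | no ¬onto with ¬∀⟶∃¬ (suc k) _ (λ i → any? λ v → p v ≟ i) ¬onto
... | i , missed =
  let (k′ , p′ , k′≤k , onto , reflects) = shrink-onto k (λ v → punchOut (i≢p v))
  in k′ , p′ , ≤-trans k′≤k (n≤1+n k) , onto ,
     λ u v eq → punchOut-injective (i≢p u) (i≢p v) (reflects u v eq)
  where
  i≢p : ∀ v → i ≢ p v
  i≢p v i≡pv = missed (v , ≡.sym i≡pv)

SymmetricDecoder⇒comm : ∀ {k} {D : Decoder k} → SymmetricDecoder D → ∀ a b → D a b ≡ D b a
SymmetricDecoder⇒comm symD a b = ⇔→≡ (symD a b)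

comm⇒SymmetricDecoder : ∀ {k} {D : Decoder k} → (∀ a b → D a b ≡ D b a) → SymmetricDecoder D
comm⇒SymmetricDecoder comm a b = mk⇔ (trans (≡.sym (comm a b))) (trans (comm a b))

letterAdj-distinct : ∀ {k m} {D : Decoder k} → (∀ a b → D a b ≡ D b a) →
  (w : Fin m → Fin k) → ∀ {i j} → i ≢ j → letterAdj D w i j ≡ D (w i) (w j)
letterAdj-distinct {D = D} comm w {i} {j} i≢j with i <? j | j <? i
... | yes _ | _     = refl
... | no _  | yes _ = comm (w j) (w i)
... | no i≮j | no j≮i with <-cmp i j
...   | tri< i<j _ _ = contradiction i<j i≮j
...   | tri≈ _ i≡j _ = contradiction i≡j i≢j
...   | tri> _ _ j<i = contradiction j<i j≮i

module _ (G : Graph) where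

  AdjFactors : ∀ {k} → (Fin (n G) → Fin k) → Decoder k → Set
  AdjFactors q D = ∀ x y → x ≢ y → adj G x y ≡ D (q x) (q y)

  IsTwinLabelling : ∀ {k} → (Fin (n G) → Fin k) → Set
  IsTwinLabelling p = ∀ u v → p u ≡ p v → GenTwins G u v

  adj-irrefl : ∀ {u x} → adj G u x ≡ true → x ≢ u
  adj-irrefl {u} ux refl with trans (≡.sym ux) (irr G u)
  ... | ()

  AdjFactors⇒IsTwinLabelling : ∀ {k q} {D : Decoder k} → AdjFactors q D → IsTwinLabelling q
  AdjFactors⇒IsTwinLabelling {q = q} {D} factors u v qu≡qv x =
    mk⇔ (λ (ux , x≢v) → transfer u v qu≡qv ux x≢v , adj-irrefl ux)
        (λ (vx , x≢u) → transfer v u (≡.sym qu≡qv) vx x≢u , adj-irrefl vx)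
    where
    transfer : ∀ u v → q u ≡ q v → adj G u x ≡ true → x ≢ v → adj G v x ≡ true
    transfer u v qu≡qv ux x≢v = begin
      adj G v x       ≡⟨ factors v x (≢-sym x≢v) ⟩
      D (q v) (q x)   ≡⟨ ≡.cong (λ a → D a (q x)) (≡.sym qu≡qv) ⟩
      D (q u) (q x)   ≡⟨ ≡.sym (factors u x (≢-sym (adj-irrefl ux))) ⟩
      adj G u x       ≡⟨ ux ⟩
      true            ∎
      where open ≡-Reasoning

  twin-adj : ∀ {b c a} → GenTwins G b c → a ≢ b → a ≢ c → adj G b a ≡ adj G c a
  twin-adj {b} {c} {a} twins a≢b a≢c = ⇔→≡ (mk⇔
    (λ ba → let (ca , _) = Equivalence.to (twins a) (ba , a≢c) in ca)
    (λ ca → let (ba , _) = Equivalence.from (twins a) (ca , a≢b) in ba))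

  -- Replace one endpoint at a time, in whichever order keeps both twin steps
  -- away from the fixed endpoint; if neither order does, (u′ , v′) = (v , u).
  IsTwinLabelling⇒adj-resp : ∀ {k} {p : Fin (n G) → Fin k} → IsTwinLabelling p →
    ∀ {u v u′ v′} → p u ≡ p u′ → p v ≡ p v′ → u ≢ v → u′ ≢ v′ → adj G u v ≡ adj G u′ v′
  IsTwinLabelling⇒adj-resp twins {u} {v} {u′} {v′} pu pv u≢v u′≢v′ with v ≟ u′
  ... | no v≢u′ = begin
    adj G u v    ≡⟨ twin-adj (twins u u′ pu) (≢-sym u≢v) v≢u′ ⟩
    adj G u′ v   ≡⟨ sym G u′ v ⟩
    adj G v u′   ≡⟨ twin-adj (twins v v′ pv) (≢-sym v≢u′) u′≢v′ ⟩
    adj G v′ u′  ≡⟨ sym G v′ u′ ⟩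
    adj G u′ v′  ∎
    where open ≡-Reasoning
  ... | yes refl with u ≟ v′
  ...   | no u≢v′ = begin
    adj G u v    ≡⟨ sym G u v ⟩
    adj G v u    ≡⟨ twin-adj (twins v v′ pv) u≢v u≢v′ ⟩
    adj G v′ u   ≡⟨ sym G v′ u ⟩
    adj G u v′   ≡⟨ twin-adj (twins u v pu) (≢-sym u≢v′) (≢-sym u′≢v′) ⟩
    adj G v v′   ∎
    where open ≡-Reasoning
  ...   | yes refl = sym G u v

  LabelledEdge : ∀ {k} → (Fin (n G) → Fin k) → Fin k → Fin k → Set
  LabelledEdge p a b = ∃₂ λ u v → p u ≡ a × p v ≡ b × u ≢ v × adj G u v ≡ true

  LabelledEdge? : ∀ {k} (p : Fin (n G) → Fin k) a b → Dec (LabelledEdge p a b)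
  LabelledEdge? p a b = any? λ u → any? λ v →
    (p u ≟ a) ×-dec (p v ≟ b) ×-dec ¬? (u ≟ v) ×-dec (adj G u v ≟ᵇ true)

  edgeDecoder : ∀ {k} → (Fin (n G) → Fin k) → Decoder k
  edgeDecoder p a b = does (LabelledEdge? p a b)

  edgeDecoder-comm : ∀ {k} (p : Fin (n G) → Fin k) a b → edgeDecoder p a b ≡ edgeDecoder p b a
  edgeDecoder-comm p a b = does-⇔ (mk⇔ flip flip) (LabelledEdge? p a b) (LabelledEdge? p b a)
    where
    flip : ∀ {a b} → LabelledEdge p a b → LabelledEdge p b a
    flip (u , v , pu , pv , u≢v , uv) = v , u , pv , pu , ≢-sym u≢v , trans (sym G v u) uv

  IsTwinLabelling⇒AdjFactors : ∀ {k} {p : Fin (n G) → Fin k} → IsTwinLabelling p →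
    AdjFactors p (edgeDecoder p)
  IsTwinLabelling⇒AdjFactors {p = p} twins x y x≢y = ⇔→≡ (mk⇔
    (λ xy → dec-true (LabelledEdge? p (p x) (p y)) (x , y , refl , refl , x≢y , xy))
    (λ e → let (u , v , pu , pv , u≢v , uv) = does-true (LabelledEdge? p (p x) (p y)) e
           in trans (IsTwinLabelling⇒adj-resp twins (≡.sym pu) (≡.sym pv) x≢y u≢v) uv))

  AdjFactors⇒≅ : ∀ {k} {p : Fin (n G) → Fin k} {D : Decoder k} →
    (∀ a b → D a b ≡ D b a) → AdjFactors p D → G ≅ letterGraph D p
  AdjFactors⇒≅ {p = p} {D} comm factors = record { bij = ⤖-id _ ; pres = pres }
    where
    pres : ∀ u v → adj G u v ≡ letterAdj D p u v
    pres u v with u ≟ v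
    ... | yes refl = trans (irr G u) (≡.sym (irr (letterGraph D p) u))
    ... | no u≢v   = trans (factors u v u≢v) (≡.sym (letterAdj-distinct comm p u≢v))

  SymLetterRep⇒AdjFactors : ∀ {k} {D : Decoder k} → SymmetricDecoder D →
    ∀ {w : Fin (n G) → Fin k} (iso : G ≅ letterGraph D w) →
    AdjFactors (w ∘ Bijection.to (_≅_.bij iso)) D
  SymLetterRep⇒AdjFactors {D = D} symD {w} iso x y x≢y =
    trans (_≅_.pres iso x y)
          (letterAdj-distinct {D = D} (SymmetricDecoder⇒comm symD) w
                              (x≢y ∘ Bijection.injective (_≅_.bij iso)))

  GenTwins? : ∀ u v → Dec (GenTwins G u v)
  GenTwins? u v = all? λ x →
    ((adj G u x ≟ᵇ true) ×-dec ¬? (x ≟ v)) ⇔-dec ((adj G v x ≟ᵇ true) ×-dec ¬? (x ≟ u))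

  TwinPartition? : ∀ k → Dec (TwinPartition G k)
  TwinPartition? k = any-function? {m = n G} resp λ p →
    IsOnto? p ×-dec (all? λ u → all? λ v → (p u ≟ p v) →-dec GenTwins? u v)
    where
    resp : ∀ {f g} → f ≗ g → IsOnto f × IsTwinLabelling f → IsOnto g × IsTwinLabelling g
    resp f≗g (onto , twins) =
      (λ i → let (v , fv) = onto i in v , trans (≡.sym (f≗g v)) fv) ,
      (λ u v gu≡gv → twins u v (trans (f≗g u) (trans gu≡gv (≡.sym (f≗g v)))))

  discretePartition : TwinPartition G (n G)
  discretePartition = id , (λ v → v , refl) , λ { u .u refl _ → ⇔-id _ }

  TwinPartition⇒SymLetterRep : ∀ {k} → TwinPartition G k → SymLetterRep G k
  TwinPartition⇒SymLetterRep (p , _ , twins) =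
    edgeDecoder p ,
    comm⇒SymmetricDecoder (edgeDecoder-comm p) ,
    p ,
    AdjFactors⇒≅ (edgeDecoder-comm p) (IsTwinLabelling⇒AdjFactors twins)

  SymLetterRep⇒TwinPartition≤ : ∀ {k} → SymLetterRep G k → ∃ λ k′ → k′ ≤ k × TwinPartition G k′
  SymLetterRep⇒TwinPartition≤ {k} (D , symD , w , iso) =
    let twins = AdjFactors⇒IsTwinLabelling {D = D} (SymLetterRep⇒AdjFactors symD iso)
        (k′ , p′ , k′≤k , onto , reflects) = shrink-onto k (w ∘ Bijection.to (_≅_.bij iso))
    in k′ , k′≤k , p′ , onto , λ u v eq → twins u v (reflects u v eq)

theorem4 : (G : Graph) → ∃ λ (m : ℕ) → IsSymLettericity G m × IsNeighbourhoodDiversity G m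
theorem4 G =
  let (m , partition , minimal) = least (TwinPartition? G) (n G) (discretePartition G)
  in m ,
     (TwinPartition⇒SymLetterRep G partition ,
      λ k rep → let (k′ , k′≤k , partition′) = SymLetterRep⇒TwinPartition≤ G rep
                in ≤-trans (minimal k′ partition′) k′≤k) ,
     (partition , minimal)
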